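{- For a semitable $a(x,y,z)$ and natural numbers $m,p,q$, the terms $a(S(0),S^m(0),\mathrm{pr}(\mathrm{pr}(0,0),k))$ and $\mathrm{pr}(\mathrm{pr}(S^p(0),S^q(0)),a(0,0,k))$ are syntactically identical iff $q=m\cdot p$ and $a(x,y,z)$ is an $(m,p)$-semitable.
   Context: A first-order language containing distinct constants $0,k$, a unary function symbol $S$ and a binary function symbol $\mathrm{pr}$; $S^0(t)=t$, $S^{m+1}(t)=S(S^m(t))$. Fix distinct variables $x,y,z$. Semitables: $z$ is a semitable; if $a(x,y,z)$ is a semitable and $p,q\ge0$, then $\mathrm{pr}(\mathrm{pr}(S^p(x),S^q(y)),a(x,y,z))$ is a semitable. $(m,p)$-semitables: $z$ is an $(m,0)$-semitable; if $a(x,y,z)$ is an $(m,p)$-semitable then $\mathrm{pr}(\mathrm{pr}(S^p(x),S^{m\cdot p}(y)),a(x,y,z))$ is an $(m,p+1)$-semitable. $a(t_1,t_2,t_3)$ denotes the result of substituting $t_1,t_2,t_3$ for $x,y,z$. -}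

module Defs where

open import Data.Nat using (ℕ; zero; suc; _*_)

data Term : Set where
  var  : ℕ → Term
  zer  : Term
  kk   : Term
  S    : Term → Term
  pr   : Term → Term → Term

S^ : ℕ → Term → Term
S^ zero    t = t
S^ (suc m) t = S (S^ m t)

x y z : Term
x = var 0
y = var 1
z = var 2

-- a(t1,t2,t3): simultaneous substitution of t1,t2,t3 for x,y,z
subst3 : Term → Term → Term → Term → Term
subst3 (var n) t1 t2 t3 with n
... | 0 = t1
... | 1 = t2
... | 2 = t3
... | suc (suc (suc j)) = var (suc (suc (suc j)))
subst3 zer     t1 t2 t3 = zer
subst3 kk      t1 t2 t3 = kk
subst3 (S t)   t1 t2 t3 = S (subst3 t t1 t2 t3)
subst3 (pr t u) t1 t2 t3 = pr (subst3 t t1 t2 t3) (subst3 u t1 t2 t3)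

data Semitable : Term → Set where
  st-z  : Semitable z
  st-pr : ∀ {a} (p q : ℕ) → Semitable a →
          Semitable (pr (pr (S^ p x) (S^ q y)) a)

data MPSemitable (m : ℕ) : ℕ → Term → Set where
  mp-z  : MPSemitable m 0 z
  mp-pr : ∀ {a p} → MPSemitable m p a →
          MPSemitable m (suc p) (pr (pr (S^ p x) (S^ (m * p) y)) a)

-- Substituting S(0), S^m(0) for x, y turns each row pr(S^p x, S^q y) of a semitable into
-- pr(S^(p+1) 0, S^(q+m) 0), while z becomes the row pr(0, 0) in front of k.  So the left-hand
-- side is the list of rows of a shifted by (1, m), and the right-hand side is the same list
-- with (p, q) prepended.  Comparing row by row, the rows of a must be (p-1, q-m), ..., (0, 0):
-- an arithmetic progression with steps (1, m), which is exactly an (m,p)-semitable.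
module Submission where

open import Defs
open import Data.Nat using (ℕ; zero; suc; _+_; _*_)
open import Data.Nat.Properties using (+-comm; +-cancelʳ-≡; *-suc; *-zeroʳ)
open import Data.Product using (_×_; _,_; proj₁)
open import Function.Bundles using (_⇔_; mk⇔; Equivalence)
open import Relation.Binary.PropositionalEquality
open ≡-Reasoning

*-sucʳ-+ : ∀ m n → m * suc n ≡ m * n + m
*-sucʳ-+ m n = trans (*-suc m n) (+-comm m (m * n))

S^-+ : ∀ m n t → S^ m (S^ n t) ≡ S^ (m + n) t
S^-+ zero    n t = refl
S^-+ (suc m) n t = cong S (S^-+ m n t)

S^-S : ∀ n t → S^ n (S t) ≡ S (S^ n t)
S^-S zero    t = refl
S^-S (suc n) t = cong S (S^-S n t)

leadingS : Term → ℕ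
leadingS (S t) = suc (leadingS t)
leadingS _     = zero

leadingS-S^ : ∀ n t → leadingS (S^ n t) ≡ n + leadingS t
leadingS-S^ zero    t = refl
leadingS-S^ (suc n) t = cong suc (leadingS-S^ n t)

S^-injectiveˡ : ∀ {m n} t → S^ m t ≡ S^ n t → m ≡ n
S^-injectiveˡ {m} {n} t e = +-cancelʳ-≡ (leadingS t) m n (begin
  m + leadingS t   ≡⟨ sym (leadingS-S^ m t) ⟩
  leadingS (S^ m t) ≡⟨ cong leadingS e ⟩
  leadingS (S^ n t) ≡⟨ leadingS-S^ n t ⟩
  n + leadingS t   ∎)

pr-injective : ∀ {a b c d} → pr a b ≡ pr c d → a ≡ c × b ≡ d
pr-injective refl = refl , refl

subst3-S^ : ∀ n t {t₁ t₂ t₃} → subst3 (S^ n t) t₁ t₂ t₃ ≡ S^ n (subst3 t t₁ t₂ t₃)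
subst3-S^ zero    t = refl
subst3-S^ (suc n) t = cong S (subst3-S^ n t)

row : ℕ → ℕ → Term → Term → Term
row p q u v = pr (S^ p u) (S^ q v)

row-injective : ∀ {p q p′ q′ u v} → row p q u v ≡ row p′ q′ u v → p ≡ p′ × q ≡ q′
row-injective {u = u} {v} e with pr-injective e
... | e₁ , e₂ = S^-injectiveˡ u e₁ , S^-injectiveˡ v e₂

subst3-row : ∀ p q {t₁ t₂ t₃} → subst3 (row p q x y) t₁ t₂ t₃ ≡ row p q t₁ t₂
subst3-row p q = cong₂ pr (subst3-S^ p x) (subst3-S^ q y)

row-shift : ∀ p q m → row p q (S zer) (S^ m zer) ≡ row (suc p) (q + m) zer zer
row-shift p q m = cong₂ pr (S^-S p zer) (S^-+ q m zer)

shifted : ℕ → Term → Term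
shifted m a = subst3 a (S zer) (S^ m zer) (pr (pr zer zer) kk)

grounded : Term → Term
grounded a = subst3 a zer zer kk

Prefixed : ℕ → ℕ → ℕ → Term → Set
Prefixed m p q a = shifted m a ≡ pr (row p q zer zer) (grounded a)

Prefixed-row⇔ : ∀ m p q p₁ q₁ a →
  Prefixed m p q (pr (row p₁ q₁ x y) a) ⇔ (suc p₁ ≡ p × q₁ + m ≡ q × Prefixed m p₁ q₁ a)
Prefixed-row⇔ m p q p₁ q₁ a = mk⇔ to from
  where
  shifted-row : shifted m (pr (row p₁ q₁ x y) a) ≡ pr (row (suc p₁) (q₁ + m) zer zer) (shifted m a)
  shifted-row = cong₂ pr (trans (subst3-row p₁ q₁) (row-shift p₁ q₁ m)) refl

  grounded-row : grounded (pr (row p₁ q₁ x y) a) ≡ pr (row p₁ q₁ zer zer) (grounded a)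
  grounded-row = cong₂ pr (subst3-row p₁ q₁) refl

  to : Prefixed m p q (pr (row p₁ q₁ x y) a) → suc p₁ ≡ p × q₁ + m ≡ q × Prefixed m p₁ q₁ a
  to e with pr-injective (trans (sym shifted-row) (trans e (cong (pr _) grounded-row)))
  ... | heads , tails with row-injective heads
  ...   | p-eq , q-eq = p-eq , q-eq , tails

  from : suc p₁ ≡ p × q₁ + m ≡ q × Prefixed m p₁ q₁ a → Prefixed m p q (pr (row p₁ q₁ x y) a)
  from (refl , refl , tails) = begin
    shifted m (pr (row p₁ q₁ x y) a)                         ≡⟨ shifted-row ⟩
    pr (row p q zer zer) (shifted m a)                       ≡⟨ cong (pr _) tails ⟩
    pr (row p q zer zer) (pr (row p₁ q₁ zer zer) (grounded a)) ≡⟨ cong (pr _) (sym grounded-row) ⟩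
    pr (row p q zer zer) (grounded (pr (row p₁ q₁ x y) a))     ∎

Prefixed⇒MPSemitable : ∀ {a} → Semitable a → ∀ m p q →
  Prefixed m p q a → q ≡ m * p × MPSemitable m p a
Prefixed⇒MPSemitable st-z m p q e with row-injective {0} {0} (proj₁ (pr-injective e))
... | refl , refl = sym (*-zeroʳ m) , mp-z
Prefixed⇒MPSemitable (st-pr {a} p₁ q₁ h) m p q e
  with Equivalence.to (Prefixed-row⇔ m p q p₁ q₁ a) e
... | refl , refl , tails with Prefixed⇒MPSemitable h m p₁ q₁ tails
...   | refl , mp = sym (*-sucʳ-+ m p₁) , mp-pr mp

MPSemitable⇒Prefixed : ∀ {m p a} → MPSemitable m p a → Prefixed m p (m * p) a
MPSemitable⇒Prefixed {m} mp-z rewrite *-zeroʳ m = refl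
MPSemitable⇒Prefixed {m} (mp-pr {a} {p} h) =
  Equivalence.from (Prefixed-row⇔ m (suc p) (m * suc p) p (m * p) a)
    (refl , sym (*-sucʳ-+ m p) , MPSemitable⇒Prefixed h)

lemma5p15 : (a : Term) → Semitable a → (m p q : ℕ) →
    (subst3 a (S zer) (S^ m zer) (pr (pr zer zer) kk)
       ≡ pr (pr (S^ p zer) (S^ q zer)) (subst3 a zer zer kk))
    ⇔ ((q ≡ m * p) × MPSemitable m p a)
lemma5p15 a h m p q = mk⇔ (Prefixed⇒MPSemitable h m p q) from
  where
  from : q ≡ m * p × MPSemitable m p a → Prefixed m p q a
  from (refl , mp) = MPSemitable⇒Prefixed mp
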